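{- Let $(A, 0, 1, \wedge, \vee, C, S_1, S_2)$ be a $T$-structure (as defined in the context). Then for all $a, b \in A$: (T8) $S_2 0 = 0$ and $S_2 1 = 1$; (T9) $a \leq b$ if and only if $S_i a \leq S_i b$ for both $i = 1, 2$; (T10) $S_1 a \leq a \leq S_2 a$; (T11) $S_i a \wedge C S_i a = 0$ and $S_i a \vee C S_i a = 1$, for $i = 1, 2$.
   Context: A $T$-structure is an algebra $(A, 0, 1, \wedge, \vee, C, S_1, S_2)$ where $0,1$ are constants, $C, S_1, S_2$ are unary operations and $\wedge, \vee$ are binary operations, such that: (T1) $(A, 0, 1, \wedge, \vee)$ is a distributive lattice with least element $0$ and greatest element $1$; and for all $a, b \in A$ and all $i, j \in \{1,2\}$: (T2) $S_i(a \wedge b) = S_i a \wedge S_i b$ and $S_i(a \vee b) = S_i a \vee S_i b$; (T3) $S_1 a \wedge C a = 0$ and $S_1 a \vee C a = 1$; (T4) $S_i S_j a = S_j a$; (T5) $S_1 0 = 0$ and $S_1 1 = 1$; (T6) if $S_i a = S_i b$ for both $i = 1, 2$, then $a = b$; (T7) $S_1 a \leq S_2 a$. Here $\leq$ is the lattice order. -}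

module Defs where

open import Level using (Level; suc; _⊔_)
open import Data.Product using (_×_)
open import Relation.Binary.Core using (Rel)
open import Algebra.Core using (Op₁)
open import Algebra.Lattice.Bundles using (DistributiveLattice)

data I₂ : Set where
  i₁ i₂ : I₂

record TStructure (c ℓ : Level) : Set (suc (c ⊔ ℓ)) where
  field
    distLattice : DistributiveLattice c ℓ
  open DistributiveLattice distLattice public

  _≤_ : Rel Carrier ℓ
  a ≤ b = (a ∧ b) ≈ a

  field
    𝟘 𝟙 : Carrier
    C : Op₁ Carrier
    S : I₂ → Op₁ Carrier
    C-cong : ∀ {a b} → a ≈ b → C a ≈ C b
    S-cong : ∀ i {a b} → a ≈ b → S i a ≈ S i b
    𝟘-least : ∀ a → 𝟘 ≤ a
    𝟙-greatest : ∀ a → a ≤ 𝟙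
    -- (T2)
    S-∧ : ∀ i a b → S i (a ∧ b) ≈ (S i a ∧ S i b)
    S-∨ : ∀ i a b → S i (a ∨ b) ≈ (S i a ∨ S i b)
    T3-∧ : ∀ a → (S i₁ a ∧ C a) ≈ 𝟘
    T3-∨ : ∀ a → (S i₁ a ∨ C a) ≈ 𝟙
    T4 : ∀ i j a → S i (S j a) ≈ S j a
    T5-𝟘 : S i₁ 𝟘 ≈ 𝟘
    T5-𝟙 : S i₁ 𝟙 ≈ 𝟙
    T6 : ∀ a b → S i₁ a ≈ S i₁ b → S i₂ a ≈ S i₂ b → a ≈ b
    T7 : ∀ a → S i₁ a ≤ S i₂ a

-- Everything rests on two observations about the axioms.
--   * Fixed points of S₁ are fixed by every S i (by T4, S i (S₁ x) = S₁ x).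
--     As 0 and 1 are such fixed points (T5), this gives (T8); as every S i a
--     is such a fixed point (T4), T3 applied to S i a gives (T11).
--   * S₁ and S₂ are monotone (T2), and together they reflect the order: if
--     S₁ a ≤ S₁ b and S₂ a ≤ S₂ b then S i (a ∧ b) = S i a for both i, so
--     a ∧ b = a by T6.  This is (T9).
-- For (T10) we combine these with the chain S₁ a ≤ S i a ≤ S₂ a (from T7):
-- applying S j to S₁ a resp. S₂ a yields S₁ a resp. S₂ a, which lies below
-- resp. above S j a, so order reflection gives S₁ a ≤ a ≤ S₂ a.
module Submission where

open import Defs
open import Level using (Level)
open import Data.Product using (_×_; _,_)
open import Function.Bundles using (_⇔_; mk⇔)
import Algebra.Lattice.Properties.Lattice as LatticeProperties

module TStructureProperties {c ℓ : Level} (T : TStructure c ℓ) where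
  open TStructure T
  open LatticeProperties lattice using (∧-idem)

  ≤-resp-≈ : ∀ {x x′ y y′} → x ≈ x′ → y ≈ y′ → x ≤ y → x′ ≤ y′
  ≤-resp-≈ x≈x′ y≈y′ x≤y = trans (∧-cong (sym x≈x′) (sym y≈y′)) (trans x≤y x≈x′)

  ≤-refl : ∀ x → x ≤ x
  ≤-refl = ∧-idem

  S-fixes-S₁-fixed : ∀ i {x} → S i₁ x ≈ x → S i x ≈ x
  S-fixes-S₁-fixed i {x} S₁x≈x = trans (S-cong i (sym S₁x≈x)) (trans (T4 i i₁ x) S₁x≈x)

  S-image-S₁-fixed : ∀ i a → S i₁ (S i a) ≈ S i a
  S-image-S₁-fixed i = T4 i₁ i

  -- Fixed points of S₁ are complemented by C (axiom T3 rewritten along S₁ x ≈ x).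
  C-complements-S₁-fixed : ∀ {x} → S i₁ x ≈ x → ((x ∧ C x) ≈ 𝟘) × ((x ∨ C x) ≈ 𝟙)
  C-complements-S₁-fixed {x} S₁x≈x =
      trans (∧-cong (sym S₁x≈x) refl) (T3-∧ x)
    , trans (∨-cong (sym S₁x≈x) refl) (T3-∨ x)

  -- Each S i is monotone, since it preserves meets (T2).
  S-monotone : ∀ i {a b} → a ≤ b → S i a ≤ S i b
  S-monotone i {a} {b} a≤b = trans (sym (S-∧ i a b)) (S-cong i a≤b)

  -- S₁ and S₂ jointly reflect the order: apply T6 to a ∧ b and a.
  S-reflects-≤ : ∀ {a b} → S i₁ a ≤ S i₁ b → S i₂ a ≤ S i₂ b → a ≤ b
  S-reflects-≤ {a} {b} S₁a≤S₁b S₂a≤S₂b =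
    T6 (a ∧ b) a (trans (S-∧ i₁ a b) S₁a≤S₁b) (trans (S-∧ i₂ a b) S₂a≤S₂b)

  S₁-least : ∀ i a → S i₁ a ≤ S i a
  S₁-least i₁ a = ≤-refl (S i₁ a)
  S₁-least i₂ a = T7 a

  S₂-greatest : ∀ i a → S i a ≤ S i₂ a
  S₂-greatest i₁ a = T7 a
  S₂-greatest i₂ a = ≤-refl (S i₂ a)

  S₂-𝟘 : S i₂ 𝟘 ≈ 𝟘
  S₂-𝟘 = S-fixes-S₁-fixed i₂ T5-𝟘

  S₂-𝟙 : S i₂ 𝟙 ≈ 𝟙
  S₂-𝟙 = S-fixes-S₁-fixed i₂ T5-𝟙

  ≤⇔S-≤ : ∀ a b → (a ≤ b) ⇔ ((S i₁ a ≤ S i₁ b) × (S i₂ a ≤ S i₂ b))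
  ≤⇔S-≤ a b = mk⇔ (λ a≤b → S-monotone i₁ a≤b , S-monotone i₂ a≤b)
                  (λ (S₁≤ , S₂≤) → S-reflects-≤ S₁≤ S₂≤)

  -- (T10): S j (S₁ a) = S₁ a ≤ S j a and S j a ≤ S₂ a = S j (S₂ a) for both j.
  S₁-below : ∀ a → S i₁ a ≤ a
  S₁-below a = S-reflects-≤ (below i₁) (below i₂)
    where
    below : ∀ j → S j (S i₁ a) ≤ S j a
    below j = ≤-resp-≈ (sym (T4 j i₁ a)) refl (S₁-least j a)

  S₂-above : ∀ a → a ≤ S i₂ a
  S₂-above a = S-reflects-≤ (above i₁) (above i₂)
    where
    above : ∀ j → S j a ≤ S j (S i₂ a)
    above j = ≤-resp-≈ refl (sym (T4 j i₂ a)) (S₂-greatest j a)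

  C-complements-S : ∀ i a → ((S i a ∧ C (S i a)) ≈ 𝟘) × ((S i a ∨ C (S i a)) ≈ 𝟙)
  C-complements-S i a = C-complements-S₁-fixed (S-image-S₁-fixed i a)

proposition2p2 : ∀ {c ℓ : Level} (T : TStructure c ℓ) → let open TStructure T in
    -- (T8)
    ((S i₂ 𝟘 ≈ 𝟘) × (S i₂ 𝟙 ≈ 𝟙))
    × (∀ a b →
        -- (T9)
        ((a ≤ b) ⇔ ((S i₁ a ≤ S i₁ b) × (S i₂ a ≤ S i₂ b)))
        -- (T10)
        × ((S i₁ a ≤ a) × (a ≤ S i₂ a))
        -- (T11)
        × (∀ i → ((S i a ∧ C (S i a)) ≈ 𝟘) × ((S i a ∨ C (S i a)) ≈ 𝟙)))
proposition2p2 T =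
    (S₂-𝟘 , S₂-𝟙)
  , λ a b → ≤⇔S-≤ a b , (S₁-below a , S₂-above a) , λ i → C-complements-S i a
  where open TStructureProperties T
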